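{- Let $X$, $Y$ be finite nonempty sets, $F: X\to 2^Y$ a set-valued mapping, $(W_1,\ldots,W_m)$ with $m\ge 2$ a Hall partition of $F$, and $1\le i\le m$ such that $W_i$ is a critical set of $F$. Then the tuple $(W_1,\ldots,W_{i-1},W_{i+1},\ldots,W_m)$ (obtained by deleting $W_i$ and keeping the order of the others) is a Hall partition of $F_{W_i}$.
   Context: A set-valued mapping $F: X \to 2^Y$ assigns to each $x$ a (possibly empty) subset $F(x) \subset Y$; $F(W) = \bigcup_{x\in W}F(x)$; $\sharp$ is cardinality. For a set-valued $G$ with finite domain $D$ and $W\subset D$, $G_W: D\setminus W \to 2^Y$ is $G_W(x) = G(x) \setminus G(W)$ ($G_\emptyset=G$). A subset $W$ of $D$ is critical for $G$ if $W\ne\emptyset$ and $\sharp G(W)=\sharp W$; non-reducible for $G$ if $W\ne\emptyset$ and no proper subset of $W$ is critical for $G$. A tuple $(V_1,\ldots,V_k)$, $k\ge1$, is a Hall partition of $G$ if the $V_i$ are nonempty, pairwise disjoint with union $D$, and with $G_i = G_{V_1\cup\cdots\cup V_{i-1}}$ ($G_1=G$): (i) $G_i(x)\neq\emptyset$ for $x \in V_i$; (ii) $V_i$ is non-reducible for $G_i$; (iii) $V_i$ is critical for $G_i$ for $i \le k-1$. -}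

module Defs where

open import Data.Nat using (ℕ; suc; _≤_; _<_)
open import Data.Fin using (Fin; toℕ; punchIn)
open import Data.Fin.Properties using (_<?_)
open import Data.Fin.Subset using (Subset; _∈_; _⊆_; _⊂_; _∩_; _∪_; _─_; ⋃; ∣_∣; Nonempty; Empty)
open import Data.Fin.Subset.Properties using (_∈?_)
open import Data.List using (List; map; filter)
open import Data.List.Base using (allFin)
open import Data.Product using (_×_)
open import Relation.Binary.PropositionalEquality using (_≡_; _≢_)
open import Relation.Nullary using (¬_)

-- Convention: X = Fin n, Y = Fin p.  A set-valued mapping G with finite
-- domain D ⊆ X is represented by the pair (D , G) with G : Fin n → Subset p;
-- the values of G outside D are irrelevant.

image : ∀ {n p} → (Fin n → Subset p) → Subset n → Subset p
image {n} G W = ⋃ (map G (filter (_∈? W) (allFin n)))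

-- G_W(x) = G(x) \ G(W)   (its domain is D ─ W)
restrict : ∀ {n p} → (Fin n → Subset p) → Subset n → (Fin n → Subset p)
restrict G W x = G x ─ image G W

Critical : ∀ {n p} → Subset n → (Fin n → Subset p) → Subset n → Set
Critical D G W = W ⊆ D × Nonempty W × ∣ image G W ∣ ≡ ∣ W ∣

NonReducible : ∀ {n p} → Subset n → (Fin n → Subset p) → Subset n → Set
NonReducible D G W = W ⊆ D × Nonempty W × (∀ U → U ⊂ W → ¬ Critical D G U)

-- V₁ ∪ ⋯ ∪ V_{i-1}  (0-based: union of V j for j < i)
prefix : ∀ {n k} → (Fin k → Subset n) → Fin k → Subset n
prefix {k = k} V i = ⋃ (map V (filter (_<? i) (allFin k)))

-- Hall partition (V₁,…,V_k) of G with domain D; indices are 0-based Fin k.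
record IsHallPartition {n p k : ℕ} (D : Subset n) (G : Fin n → Subset p)
                       (V : Fin k → Subset n) : Set where
  field
    k≥1       : 1 ≤ k
    nonempty  : ∀ i → Nonempty (V i)
    disjoint  : ∀ i j → i ≢ j → Empty (V i ∩ V j)
    covers    : ⋃ (map V (allFin k)) ≡ D
    values    : ∀ i x → x ∈ V i → Nonempty (restrict G (prefix V i) x)
    nonRed    : ∀ i → NonReducible (D ─ prefix V i) (restrict G (prefix V i)) (V i)
    critical  : ∀ i → suc (toℕ i) < k →
                Critical (D ─ prefix V i) (restrict G (prefix V i)) (V i)

deleteAt : ∀ {n m} → Fin (suc m) → (Fin (suc m) → Subset n) → (Fin m → Subset n)
deleteAt i W j = W (punchIn i j)

-- Deleting a critical block W_i changes none of the restricted mappings seen by the other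
-- blocks.  The Hall inequality ∣U∣ ≤ ∣G(U)∣, valid on every non-reducible set, applied to
-- W_i and G_i = F_{W_1 ∪ ⋯ ∪ W_{i-1}} gives ∣F(W_i)∣ = ∣W_i∣ ≤ ∣G_i(W_i)∣, and since
-- G_i(W_i) ⊆ F(W_i) the two are equal; hence F(W_i) is disjoint from the values of the
-- earlier blocks.  So for every other block W_o, removing F(W_i) before the earlier blocks
-- is the same as restricting F to the earlier blocks of the original partition: for o < i
-- because F(W_i) already misses the values on W_o, for o > i because W_i is one of those
-- earlier blocks.  All conditions on W_o therefore transfer verbatim.
module Submission where

open import Defs
open import Data.Nat using (ℕ; suc; _≤_; _<_; z≤n; s≤s; s≤s⁻¹)
import Data.Nat.Properties as ℕ
open import Data.Nat.Induction using (<-wellFounded)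
open import Data.Fin using (Fin; toℕ; punchIn; punchOut)
import Data.Fin as Fin
import Data.Fin.Properties as Fin
open import Data.Fin.Subset
open import Data.Fin.Subset.Properties
open import Data.Vec using (_∷_; here; there)
open import Data.List using (List; map; filter; allFin; _∷_; [])
import Data.List.Membership.Propositional as List
open import Data.List.Membership.Propositional.Properties using (∈-filter⁺; ∈-filter⁻; ∈-allFin)
open import Data.List.Relation.Unary.Any using (here; there)
open import Data.Product using (_×_; _,_; proj₁; proj₂; ∃)
open import Data.Sum using (inj₁; inj₂)
open import Function using (_∘_)
open import Induction.WellFounded using (Acc; acc)
open import Relation.Binary.Definitions using (tri<; tri≈; tri>)
open import Relation.Binary.PropositionalEquality
open import Relation.Nullary using (yes; no; contradiction)
open import Relation.Unary using (Pred; Decidable)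

private variable
  n p k : ℕ

x∈p─q⇒x∉q : ∀ {x : Fin n} {p q : Subset n} → x ∈ p ─ q → x ∉ q
x∈p─q⇒x∉q {p = _ ∷ _} {outside ∷ _} here      ()
x∈p─q⇒x∉q {p = _ ∷ _} {inside ∷ _}  ()        here
x∈p─q⇒x∉q {p = _ ∷ _} {outside ∷ _} (there h) (there k) = x∈p─q⇒x∉q h k
x∈p─q⇒x∉q {p = _ ∷ _} {inside ∷ _}  (there h) (there k) = x∈p─q⇒x∉q h k

x∈p─q⁻ : ∀ {x : Fin n} {p q : Subset n} → x ∈ p ─ q → x ∈ p × x ∉ q
x∈p─q⁻ {p = p} {q} h = p─q⊆p p q h , x∈p─q⇒x∉q h

x∈⋃map⁻ : ∀ {A : Set} (V : A → Subset n) (as : List A) {x} →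
          x ∈ ⋃ (map V as) → ∃ λ a → a List.∈ as × x ∈ V a
x∈⋃map⁻ V []       h = contradiction h ∉⊥
x∈⋃map⁻ V (a ∷ as) h with x∈p∪q⁻ (V a) _ h
... | inj₁ x∈Va = a , here refl , x∈Va
... | inj₂ x∈⋃ with x∈⋃map⁻ V as x∈⋃
...   | b , b∈as , x∈Vb = b , there b∈as , x∈Vb

x∈⋃map⁺ : ∀ {A : Set} (V : A → Subset n) (as : List A) {x a} →
          a List.∈ as → x ∈ V a → x ∈ ⋃ (map V as)
x∈⋃map⁺ V (a ∷ as) (here refl) x∈Va = x∈p∪q⁺ (inj₁ x∈Va)
x∈⋃map⁺ V (a ∷ as) (there b∈as) x∈Vb = x∈p∪q⁺ (inj₂ (x∈⋃map⁺ V as b∈as x∈Vb))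

x∈⋃filter⁻ : ∀ {ℓ} {P : Pred (Fin k) ℓ} (P? : Decidable P) (V : Fin k → Subset n) {x} →
             x ∈ ⋃ (map V (filter P? (allFin k))) → ∃ λ a → P a × x ∈ V a
x∈⋃filter⁻ {k = k} P? V h with x∈⋃map⁻ V (filter P? (allFin k)) h
... | a , a∈as , x∈Va = a , proj₂ (∈-filter⁻ P? {xs = allFin k} a∈as) , x∈Va

x∈⋃filter⁺ : ∀ {ℓ} {P : Pred (Fin k) ℓ} (P? : Decidable P) (V : Fin k → Subset n) {x a} →
             P a → x ∈ V a → x ∈ ⋃ (map V (filter P? (allFin k)))
x∈⋃filter⁺ {k = k} P? V Pa = x∈⋃map⁺ V (filter P? (allFin k)) (∈-filter⁺ P? (∈-allFin _) Pa)

∣p∣≡1+∣p-x∣ : ∀ {x : Fin n} {p : Subset n} → x ∈ p → ∣ p ∣ ≡ suc ∣ p - x ∣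
∣p∣≡1+∣p-x∣ {p = inside ∷ p}  here      = cong suc (cong ∣_∣ (sym (p─⊥≡p p)))
∣p∣≡1+∣p-x∣ {p = outside ∷ p} (there h) = ∣p∣≡1+∣p-x∣ h
∣p∣≡1+∣p-x∣ {p = inside ∷ p}  (there h) = cong suc (∣p∣≡1+∣p-x∣ h)

p⊆q∧∣q∣≤∣p∣⇒q⊆p : ∀ {p q : Subset n} → p ⊆ q → ∣ q ∣ ≤ ∣ p ∣ → q ⊆ p
p⊆q∧∣q∣≤∣p∣⇒q⊆p {p = p} p⊆q ∣q∣≤∣p∣ {y} y∈q with y ∈? p
... | yes y∈p = y∈p
... | no  y∉p = contradiction ∣q∣≤∣p∣ (ℕ.<⇒≱ (p⊂q⇒∣p∣<∣q∣ (p⊆q , y , y∈q , y∉p)))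

module _ (G : Fin n → Subset p) where

  image⁻ : ∀ {W y} → y ∈ image G W → ∃ λ x → x ∈ W × y ∈ G x
  image⁻ {W} = x∈⋃filter⁻ (_∈? W) G

  image⁺ : ∀ {W x y} → x ∈ W → y ∈ G x → y ∈ image G W
  image⁺ {W} = x∈⋃filter⁺ (_∈? W) G

  image-mono : ∀ {U W} → U ⊆ W → image G U ⊆ image G W
  image-mono U⊆W y∈GU with image⁻ y∈GU
  ... | x , x∈U , y∈Gx = image⁺ (U⊆W x∈U) y∈Gx

image-restrict-⊆ : (G : Fin n → Subset p) (P W : Subset n) → image (restrict G P) W ⊆ image G W ─ image G P
image-restrict-⊆ G P W y∈ with image⁻ (restrict G P) y∈
... | x , x∈W , y∈Gx─GP with x∈p─q⁻ y∈Gx─GP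
...   | y∈Gx , y∉GP = x∈p∧x∉q⇒x∈p─q (image⁺ G x∈W y∈Gx) y∉GP

image-cong : ∀ {G H : Fin n → Subset p} {U} →
             (∀ x → x ∈ U → G x ≡ H x) → image G U ≡ image H U
image-cong G≗H = ⊆-antisym (transport G≗H) (transport (λ x x∈U → sym (G≗H x x∈U)))
  where
  transport : ∀ {G H : Fin _ → Subset _} {U} → (∀ x → x ∈ U → G x ≡ H x) → image G U ⊆ image H U
  transport {G} {H} G≗H y∈GU with image⁻ G y∈GU
  ... | x , x∈U , y∈Gx = image⁺ H x∈U (subst (_ ∈_) (G≗H x x∈U) y∈Gx)

module _ {D D′ U : Subset n} {G H : Fin n → Subset p}
         (U⊆D′ : U ⊆ D′) (G≗H : ∀ x → x ∈ U → G x ≡ H x) where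

  critical-cong : Critical D G U → Critical D′ H U
  critical-cong (_ , U≢∅ , ∣GU∣≡∣U∣) =
    U⊆D′ , U≢∅ , trans (cong ∣_∣ (image-cong (λ x x∈U → sym (G≗H x x∈U)))) ∣GU∣≡∣U∣

nonReducible-cong : ∀ {D D′ W : Subset n} {G H : Fin n → Subset p} →
                    W ⊆ D′ → (∀ x → x ∈ W → G x ≡ H x) → NonReducible D G W → NonReducible D′ H W
nonReducible-cong W⊆D′ G≗H (W⊆D , W≢∅ , irreducible) =
  W⊆D′ , W≢∅ , λ U U⊂W U-critical →
    irreducible U U⊂W
      (critical-cong (⊆-trans (proj₁ U⊂W) W⊆D) (λ x x∈U → sym (G≗H x (proj₁ U⊂W x∈U))) U-critical)

module _ {D W : Subset n} {G : Fin n → Subset p}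
         (W-nonRed : NonReducible D G W) (G≢∅ : ∀ x → x ∈ W → Nonempty (G x)) where

  private
    proper-strict : ∀ {U} → U ⊂ W → Nonempty U → ∣ U ∣ ≤ ∣ image G U ∣ → ∣ U ∣ < ∣ image G U ∣
    proper-strict {U} U⊂W U≢∅ ∣U∣≤ = ℕ.≤∧≢⇒< ∣U∣≤ λ ∣U∣≡ →
      proj₂ (proj₂ W-nonRed) U U⊂W (⊆-trans (proj₁ U⊂W) (proj₁ W-nonRed) , U≢∅ , sym ∣U∣≡)

    hall : ∀ {U} → Acc _<_ ∣ U ∣ → U ⊆ W → Nonempty U → ∣ U ∣ ≤ ∣ image G U ∣
    hall {U} (acc smaller) U⊆W (x , x∈U) with nonempty? (U - x) | G≢∅ x (U⊆W x∈U)
    ... | no U-x≡∅ | y , y∈Gx = begin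
      ∣ U ∣                          ≡⟨ ∣p∣≡1+∣p-x∣ x∈U ⟩
      suc ∣ U - x ∣                  ≡⟨ cong (suc ∘ ∣_∣) (Empty-unique U-x≡∅) ⟩
      suc ∣ ⊥ {n = n} ∣              ≡⟨ cong suc (∣⊥∣≡0 n) ⟩
      1                              ≤⟨ s≤s z≤n ⟩
      suc ∣ image G U - y ∣          ≡⟨ ∣p∣≡1+∣p-x∣ (image⁺ G x∈U y∈Gx) ⟨
      ∣ image G U ∣                  ∎
      where open ℕ.≤-Reasoning
    ... | yes U-x≢∅ | _ = begin
      ∣ U ∣                          ≡⟨ ∣p∣≡1+∣p-x∣ x∈U ⟩
      suc ∣ U - x ∣                  ≤⟨ proper-strict U-x⊂W U-x≢∅ (hall (smaller ∣U-x∣<∣U∣) (proj₁ U-x⊂W) U-x≢∅) ⟩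
      ∣ image G (U - x) ∣            ≤⟨ p⊆q⇒∣p∣≤∣q∣ (image-mono G (p─q⊆p U _)) ⟩
      ∣ image G U ∣                  ∎
      where
      open ℕ.≤-Reasoning
      ∣U-x∣<∣U∣ = x∈p⇒∣p-x∣<∣p∣ x∈U
      U-x⊂W = ⊂-⊆-trans (x∈p⇒p-x⊂p x∈U) U⊆W

  nonReducible⇒hall : ∀ {U} → U ⊆ W → Nonempty U → ∣ U ∣ ≤ ∣ image G U ∣
  nonReducible⇒hall = hall (<-wellFounded _)

module _ {D P W : Subset n} {F : Fin n → Subset p}
         (W-nonRed : NonReducible D (restrict F P) W)
         (F_P≢∅ : ∀ x → x ∈ W → Nonempty (restrict F P x))
         (∣FW∣≡∣W∣ : ∣ image F W ∣ ≡ ∣ W ∣) where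

  critical⇒image-disjoint : ∀ {y} → y ∈ image F P → y ∉ image F W
  critical⇒image-disjoint y∈FP y∈FW = x∈p─q⇒x∉q (image-restrict-⊆ F P W (FW⊆F_P[W] y∈FW)) y∈FP
    where
    FW⊆F_P[W] : image F W ⊆ image (restrict F P) W
    FW⊆F_P[W] = p⊆q∧∣q∣≤∣p∣⇒q⊆p (p─q⊆p _ _ ∘ image-restrict-⊆ F P W)
      (subst (_≤ ∣ image (restrict F P) W ∣) (sym ∣FW∣≡∣W∣)
        (nonReducible⇒hall W-nonRed F_P≢∅ ⊆-refl (proj₁ (proj₂ W-nonRed))))

toℕ-punchIn-≤ : ∀ {m} (i : Fin (suc m)) (j : Fin m) → toℕ (punchIn i j) ≤ suc (toℕ j)
toℕ-punchIn-≤ Fin.zero    j           = ℕ.≤-refl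
toℕ-punchIn-≤ (Fin.suc i) Fin.zero    = z≤n
toℕ-punchIn-≤ (Fin.suc i) (Fin.suc j) = s≤s (toℕ-punchIn-≤ i j)

module _ {m} (W : Fin (suc m) → Subset n) (i : Fin (suc m)) where

  x∈W⇒x∈deleteAt-punchOut : ∀ {x l} (i≢l : i ≢ l) → x ∈ W l → x ∈ deleteAt i W (punchOut i≢l)
  x∈W⇒x∈deleteAt-punchOut {x} i≢l = subst (λ t → x ∈ W t) (sym (Fin.punchIn-punchOut i≢l))

  prefix-deleteAt⊆ : ∀ j → prefix (deleteAt i W) j ⊆ prefix W (punchIn i j)
  prefix-deleteAt⊆ j x∈ with x∈⋃filter⁻ (Fin._<? j) (deleteAt i W) x∈
  ... | l , l<j , x∈Wl = x∈⋃filter⁺ (Fin._<? punchIn i j) W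
        (Fin.≤∧≢⇒< (Fin.punchIn-mono-≤ i l j (ℕ.<⇒≤ l<j)) (Fin.<⇒≢ l<j ∘ Fin.punchIn-injective i l j))
        x∈Wl

  prefix-deleteAt⊇ : ∀ j {x} → x ∈ prefix W (punchIn i j) → x ∉ W i → x ∈ prefix (deleteAt i W) j
  prefix-deleteAt⊇ j {x} x∈ x∉Wi with x∈⋃filter⁻ (Fin._<? punchIn i j) W x∈
  ... | l , l<o , x∈Wl = x∈⋃filter⁺ (Fin._<? j) (deleteAt i W) l′<j (x∈W⇒x∈deleteAt-punchOut i≢l x∈Wl)
    where
    i≢l : i ≢ l
    i≢l refl = x∉Wi x∈Wl
    l≡punchIn-l′ = sym (Fin.punchIn-punchOut i≢l)
    l′<j : punchOut i≢l Fin.< j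
    l′<j = Fin.≤∧≢⇒<
      (Fin.punchIn-cancel-≤ i _ j (subst (λ t → toℕ t ≤ toℕ (punchIn i j)) l≡punchIn-l′ (ℕ.<⇒≤ l<o)))
      (λ l′≡j → Fin.<⇒≢ l<o (trans l≡punchIn-l′ (cong (punchIn i) l′≡j)))

module DeleteCriticalBlock {m} {D : Subset n} {F : Fin n → Subset p} {W : Fin (suc m) → Subset n}
       (H : IsHallPartition D F W) (i : Fin (suc m)) (∣FWᵢ∣≡∣Wᵢ∣ : ∣ image F (W i) ∣ ≡ ∣ W i ∣) where

  open IsHallPartition H

  private
    Fᵢ = restrict F (W i)
    V  = deleteAt i W

  ∉-other-block : ∀ {x l l′} → x ∈ W l → l ≢ l′ → x ∉ W l′
  ∉-other-block x∈Wl l≢l′ x∈Wl′ = disjoint _ _ l≢l′ (_ , x∈p∩q⁺ (x∈Wl , x∈Wl′))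

  covers-deleteAt : ⋃ (map V (allFin m)) ≡ D ─ W i
  covers-deleteAt = ⊆-antisym ⊆D─Wᵢ D─Wᵢ⊆
    where
    ⊆D─Wᵢ : ⋃ (map V (allFin m)) ⊆ D ─ W i
    ⊆D─Wᵢ x∈ with x∈⋃map⁻ V (allFin m) x∈
    ... | j , _ , x∈Vj = x∈p∧x∉q⇒x∈p─q (subst (_ ∈_) covers (x∈⋃map⁺ W (allFin _) (∈-allFin _) x∈Vj))
                                       (∉-other-block x∈Vj (Fin.punchInᵢ≢i i j))
    D─Wᵢ⊆ : D ─ W i ⊆ ⋃ (map V (allFin m))
    D─Wᵢ⊆ x∈ with x∈p─q⁻ x∈
    ... | x∈D , x∉Wi with x∈⋃map⁻ W (allFin _) (subst (_ ∈_) (sym covers) x∈D)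
    ...   | l , _ , x∈Wl = x∈⋃map⁺ V (allFin m) (∈-allFin _)
                             (x∈W⇒x∈deleteAt-punchOut W i (λ { refl → x∉Wi x∈Wl }) x∈Wl)

  module _ (j : Fin m) where

    private
      o = punchIn i j

    block-domain : W o ⊆ (D ─ W i) ─ prefix V j
    block-domain x∈Wo with x∈p─q⁻ (proj₁ (nonRed o) x∈Wo)
    ... | x∈D , x∉prefix = x∈p∧x∉q⇒x∈p─q
      (x∈p∧x∉q⇒x∈p─q x∈D (∉-other-block x∈Wo (Fin.punchInᵢ≢i i j)))
      (x∉prefix ∘ prefix-deleteAt⊆ W i j)

    image-Wᵢ-avoided : ∀ {x y} → x ∈ W o → y ∈ F x → y ∉ image F (prefix W o) → y ∉ image F (W i)
    image-Wᵢ-avoided x∈Wo y∈Fx y∉ with Fin.<-cmp o i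
    ... | tri< o<i _ _ = critical⇒image-disjoint (nonRed i) (values i) ∣FWᵢ∣≡∣Wᵢ∣
                           (image⁺ F (x∈⋃filter⁺ (Fin._<? i) W o<i x∈Wo) y∈Fx)
    ... | tri≈ _ o≡i _ = contradiction o≡i (Fin.punchInᵢ≢i i j)
    ... | tri> _ _ i<o = y∉ ∘ image-mono F (x∈⋃filter⁺ (Fin._<? o) W i<o)

    restrict-deleteAt : ∀ x → x ∈ W o → restrict F (prefix W o) x ≡ restrict Fᵢ (prefix V j) x
    restrict-deleteAt x x∈Wo = ⊆-antisym old⊆new new⊆old
      where
      old⊆new : restrict F (prefix W o) x ⊆ restrict Fᵢ (prefix V j) x
      old⊆new y∈ with x∈p─q⁻ y∈
      ... | y∈Fx , y∉F[Po] = x∈p∧x∉q⇒x∈p─q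
        (x∈p∧x∉q⇒x∈p─q y∈Fx (image-Wᵢ-avoided x∈Wo y∈Fx y∉F[Po]))
        (y∉F[Po] ∘ image-mono F (prefix-deleteAt⊆ W i j) ∘ p─q⊆p _ _ ∘ image-restrict-⊆ F (W i) (prefix V j))

      new⊆old : restrict Fᵢ (prefix V j) x ⊆ restrict F (prefix W o) x
      new⊆old {y} y∈ with x∈p─q⁻ y∈
      ... | y∈Fᵢx , y∉Fᵢ[V<j] with x∈p─q⁻ y∈Fᵢx
      ...   | y∈Fx , y∉FWᵢ = x∈p∧x∉q⇒x∈p─q y∈Fx y∉F[Po]
        where
        y∉F[Po] : y ∉ image F (prefix W o)
        y∉F[Po] y∈F[Po] with image⁻ F y∈F[Po]
        ... | z , z∈Po , y∈Fz with z ∈? W i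
        ...   | yes z∈Wi = y∉FWᵢ (image⁺ F z∈Wi y∈Fz)
        ...   | no  z∉Wi = y∉Fᵢ[V<j] (image⁺ Fᵢ (prefix-deleteAt⊇ W i j z∈Po z∉Wi) (x∈p∧x∉q⇒x∈p─q y∈Fz y∉FWᵢ))

lemma6p8 : ∀ {n p m : ℕ} → 1 ≤ n → 1 ≤ p →
    (F : Fin n → Subset p) (W : Fin (suc m) → Subset n) →
    2 ≤ suc m →
    IsHallPartition ⊤ F W →
    (i : Fin (suc m)) → Critical ⊤ F (W i) →
    IsHallPartition (⊤ ─ W i) (restrict F (W i)) (deleteAt i W)
lemma6p8 _ _ F W 2≤1+m H i (_ , _ , ∣FWᵢ∣≡∣Wᵢ∣) = record
  { k≥1      = s≤s⁻¹ 2≤1+m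
  ; nonempty = nonempty ∘ punchIn i
  ; disjoint = λ j j′ j≢j′ → disjoint _ _ (j≢j′ ∘ Fin.punchIn-injective i j j′)
  ; covers   = covers-deleteAt
  ; values   = λ j x x∈Vj → subst Nonempty (restrict-deleteAt j x x∈Vj) (values _ x x∈Vj)
  ; nonRed   = λ j → nonReducible-cong (block-domain j) (restrict-deleteAt j) (nonRed _)
  ; critical = λ j 1+j<m → critical-cong (block-domain j) (restrict-deleteAt j)
                 (critical _ (s≤s (ℕ.≤-trans (s≤s (toℕ-punchIn-≤ i j)) 1+j<m)))
  }
  where
  open IsHallPartition H
  open DeleteCriticalBlock H i ∣FWᵢ∣≡∣Wᵢ∣
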